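{- For every positive integer $m$, let $\mathrm{O3}(m)$ denote the number of partitions of $m$ in which no odd part is repeated, the largest part is even, and the largest part appears exactly once; and let $\mathrm{pod}(m)$ denote the number of partitions of $m$ in which no odd part is repeated. Then for all integers $n>2$, \[ \mathrm{O3}(n+2)+\mathrm{O3}(n-1)=\mathrm{pod}(n). \]
   Context: A partition of $m$ is a finite non-increasing sequence of positive integers $\lambda_1\ge \lambda_2\ge\cdots\ge\lambda_k$ with sum $m$; its parts are the $\lambda_i$ and its largest part is $\lambda_1$. "No odd part is repeated" means every odd integer occurs at most once among the parts (even parts may repeat). -}

module Defs where

open import Data.Nat using (ℕ; zero; suc; _+_; _≤ᵇ_; _≡ᵇ_)
open import Data.Nat.Base using (_%_)
open import Data.Bool using (Bool; true; false; _∧_; _∨_; not)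
open import Data.List using (List; []; _∷_; filterᵇ; length)
open import Data.Nat.ListAction using (sum)
open import Data.Product using (Σ)
open import Data.Fin using (Fin)
open import Data.Unit using (⊤)
open import Function.Bundles using (_↔_)
open import Relation.Binary.PropositionalEquality using (_≡_)

-- Boolean tests (Bool-valued, so that the subtypes below are
-- propositional and counting via bijections with Fin k is meaningful).

isOdd : ℕ → Bool
isOdd n = n % 2 ≡ᵇ 1

allPos : List ℕ → Bool
allPos []       = true
allPos (x ∷ xs) = not (x ≡ᵇ 0) ∧ allPos xs

nonIncr : List ℕ → Bool
nonIncr []           = true
nonIncr (x ∷ [])     = true
nonIncr (x ∷ y ∷ xs) = (y ≤ᵇ x) ∧ nonIncr (y ∷ xs)

occ : ℕ → List ℕ → ℕ
occ x xs = length (filterᵇ (λ y → y ≡ᵇ x) xs)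

noOddRepeated : List ℕ → Bool
noOddRepeated xs = go xs
  where
  go : List ℕ → Bool
  go []       = true
  go (y ∷ ys) = (not (isOdd y) ∨ (occ y xs ≤ᵇ 1)) ∧ go ys

isPartition : ℕ → List ℕ → Bool
isPartition m xs = allPos xs ∧ nonIncr xs ∧ (sum xs ≡ᵇ m)

largestEvenOnce : List ℕ → Bool
largestEvenOnce []       = false
largestEvenOnce (x ∷ xs) = not (isOdd x) ∧ (occ x (x ∷ xs) ≡ᵇ 1)

data IsTrue : Bool → Set where
  itis : IsTrue true

PodSet : ℕ → Set
PodSet m = Σ (List ℕ) (λ xs → IsTrue (isPartition m xs ∧ noOddRepeated xs))

O3Set : ℕ → Set
O3Set m = Σ (List ℕ) (λ xs →
  IsTrue (isPartition m xs ∧ noOddRepeated xs ∧ largestEvenOnce xs))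

HasCard : Set → ℕ → Set
HasCard A k = Fin k ↔ A

{-# OPTIONS --safe #-}
-- Split a partition of n with no repeated odd part into its largest part x
-- and the rest r, and send it to
--   (x + 2) ∷ r          if x is even,
--   (x + 1) ∷ x ∷ r′     if x is odd and r = (x − 1) ∷ r′,
--   (x − 1) ∷ r          if x is odd otherwise.
-- The first two cases are the partitions of n + 2 counted by O3 whose second
-- part is not, respectively is, one below the largest; the third case gives
-- those of n − 1.  Inverting the three cases is the same case analysis from
-- the other side, so the map is a bijection once n ≥ 2 (for n = 1 the
-- partition 1 would be sent to 0).  All these sets are finite since a
-- partition of m is a list of length and entries at most m.
module Submission where

open import Defs
open import Data.Bool using (Bool; true; false; T; T?; not; _∧_; _∨_; if_then_else_)
open import Data.Bool.ListAction using (all)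
open import Data.Bool.Properties using (T-∧; T-not-≡; ∧-assoc)
open import Data.Empty using (⊥)
open import Data.Fin using (Fin) renaming (zero to fzero; suc to fsuc)
open import Data.Fin.Properties using (+↔⊎)
open import Data.List.Base using (List; []; _∷_; length; upTo; cartesianProductWith)
open import Data.List.Membership.Propositional using (_∈_)
open import Data.List.Membership.Propositional.Properties using (∈-cartesianProductWith⁺; ∈-upTo⁺)
open import Data.List.Properties using (filter-accept; filter-reject; ≡-dec)
open import Data.List.Relation.Unary.All as All using (All; []; _∷_)
open import Data.List.Relation.Unary.All.Properties using (all⁺; all⁻)
open import Data.List.Relation.Unary.Any using (here; there)
open import Data.List.Relation.Unary.Linked as Linked using (Linked; []; [-]; _∷_)
open import Data.List.Relation.Unary.Linked.Properties using (Linked⇒All)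
open import Data.Nat using (ℕ; zero; suc; pred; _+_; _∸_; _≤_; _<_; _≥_; z≤n; s≤s; _≤ᵇ_; _≡ᵇ_; _≟_)
open import Data.Nat.ListAction using (sum)
open import Data.Nat.Properties
open import Data.Product using (Σ; _×_; _,_; proj₁; proj₂)
open import Data.Product.Function.NonDependent.Propositional using (_×-⇔_)
open import Data.Sum using (_⊎_; inj₁; inj₂; [_,_]′)
open import Data.Sum.Function.Propositional using (_⊎-↔_)
open import Data.Unit using (tt)
open import Function using (_∘_)
open import Function.Bundles using (_⇔_; _↔_; mk⇔; mk↔ₛ′; Equivalence)
open import Function.Properties.Equivalence using () renaming (trans to ⇔-trans)
open import Function.Properties.Inverse using (↔-trans; ↔-sym)
open import Function.Related.TypeIsomorphisms using (Σ-distribʳ-⊎)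
open import Relation.Binary.Definitions using (DecidableEquality)
open import Relation.Binary.PropositionalEquality using (_≡_; refl; sym; trans; cong; subst; ≢-sym)
open import Relation.Nullary using (¬_; Dec; contradiction; does; yes; no)

open Equivalence using (to; from)

-- Subtypes of boolean predicates and their cardinalities

Subtype : {A : Set} → (A → Bool) → Set
Subtype {A} p = Σ A (λ x → IsTrue (p x))

IsTrue-irrelevant : ∀ {b} (u v : IsTrue b) → u ≡ v
IsTrue-irrelevant itis itis = refl

IsTrue⇔T : ∀ {b} → IsTrue b ⇔ T b
IsTrue⇔T {true}  = mk⇔ (λ _ → tt) (λ _ → itis)
IsTrue⇔T {false} = mk⇔ (λ ()) (λ ())

Subtype-≡ : ∀ {A} {p : A → Bool} {x y} {u : IsTrue (p x)} {v : IsTrue (p y)} →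
            x ≡ y → _≡_ {A = Subtype p} (x , u) (y , v)
Subtype-≡ refl = cong (_ ,_) (IsTrue-irrelevant _ _)

Subtype-↔ : ∀ {A B : Set} {p : A → Bool} {q : B → Bool} {P : A → Set} {Q : B → Set} →
            (∀ {x} → IsTrue (p x) ⇔ P x) → (∀ {y} → IsTrue (q y) ⇔ Q y) →
            (f : A → B) (g : B → A) →
            (∀ {x} → P x → Q (f x)) → (∀ {y} → Q y → P (g y)) →
            (∀ {x} → P x → g (f x) ≡ x) → (∀ {y} → Q y → f (g y) ≡ y) →
            Subtype p ↔ Subtype q
Subtype-↔ p⇔P q⇔Q f g f-sound g-sound g∘f f∘g = mk↔ₛ′ f′ g′ f′∘g′ g′∘f′
  where
  f′ : Subtype _ → Subtype _
  f′ (x , u) = f x , from (q⇔Q {f x}) (f-sound {x} (to p⇔P u))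
  g′ : Subtype _ → Subtype _
  g′ (y , v) = g y , from (p⇔P {g y}) (g-sound {y} (to q⇔Q v))
  f′∘g′ : ∀ s → f′ (g′ s) ≡ s
  f′∘g′ (y , v) = Subtype-≡ (f∘g {y} (to q⇔Q v))
  g′∘f′ : ∀ s → g′ (f′ s) ≡ s
  g′∘f′ (x , u) = Subtype-≡ (g∘f {x} (to p⇔P u))

HasCard-⊎ : ∀ {A B a b} → HasCard A a → HasCard B b → HasCard (A ⊎ B) (a + b)
HasCard-⊎ {a = a} |A| |B| = ↔-trans (+↔⊎ {a}) (|A| ⊎-↔ |B|)

IsTrue-card : (b : Bool) → Σ ℕ (HasCard (IsTrue b))
IsTrue-card false = 0 , mk↔ₛ′ (λ ()) (λ ()) (λ ()) (λ ())
IsTrue-card true  =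
  1 , mk↔ₛ′ (λ _ → itis) (λ _ → fzero) (λ { itis → refl }) (λ { fzero → refl ; (fsuc ()) })

module _ {A : Set} (_≟ᴬ_ : DecidableEquality A) where

  _∖_ : (A → Bool) → A → (A → Bool)
  (p ∖ y) x = not (does (x ≟ᴬ y)) ∧ p x

  ∖-intro : ∀ (p : A → Bool) {x y} → ¬ x ≡ y → IsTrue (p x) → IsTrue ((p ∖ y) x)
  ∖-intro p {x} {y} x≢y u with x ≟ᴬ y
  ... | yes x≡y = contradiction x≡y x≢y
  ... | no  _   = u

  ∖-elim : ∀ (p : A → Bool) {x y} → IsTrue ((p ∖ y) x) → ¬ x ≡ y × IsTrue (p x)
  ∖-elim p {x} {y} u with x ≟ᴬ y
  ∖-elim p () | yes _
  ... | no x≢y = x≢y , u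

  Subtype-split : (p : A → Bool) (y : A) → (IsTrue (p y) ⊎ Subtype (p ∖ y)) ↔ Subtype p
  Subtype-split p y = mk↔ₛ′ f (λ (x , u) → g u (x ≟ᴬ y)) (λ (x , u) → f∘g u (x ≟ᴬ y)) g∘f
    where
    f : IsTrue (p y) ⊎ Subtype (p ∖ y) → Subtype p
    f (inj₁ u)       = y , u
    f (inj₂ (x , u)) = x , proj₂ (∖-elim p u)
    g : ∀ {x} → IsTrue (p x) → Dec (x ≡ y) → IsTrue (p y) ⊎ Subtype (p ∖ y)
    g u (yes x≡y)      = inj₁ (subst (IsTrue ∘ p) x≡y u)
    g {x} u (no x≢y)   = inj₂ (x , ∖-intro p x≢y u)
    f∘g : ∀ {x} (u : IsTrue (p x)) d → f (g u d) ≡ (x , u)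
    f∘g u (yes x≡y) = Subtype-≡ (sym x≡y)
    f∘g u (no  _)   = Subtype-≡ refl
    g∘f : ∀ s → g (proj₂ (f s)) (proj₁ (f s) ≟ᴬ y) ≡ s
    g∘f (inj₁ u)       = g-≡ (y ≟ᴬ y)
      where
      g-≡ : ∀ d → g u d ≡ inj₁ u
      g-≡ (yes _)   = cong inj₁ (IsTrue-irrelevant _ _)
      g-≡ (no  y≢y) = contradiction refl y≢y
    g∘f (inj₂ (x , u)) = g-≢ (x ≟ᴬ y)
      where
      g-≢ : ∀ d → g (proj₂ (∖-elim p u)) d ≡ inj₂ (x , u)
      g-≢ (yes x≡y) = contradiction x≡y (proj₁ (∖-elim p u))
      g-≢ (no  _)   = cong inj₂ (Subtype-≡ refl)

  Subtype-finite : (p : A → Bool) (L : List A) → (∀ {x} → IsTrue (p x) → x ∈ L) →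
                   Σ ℕ (HasCard (Subtype p))
  Subtype-finite p [] covers =
    0 , mk↔ₛ′ (λ ()) (λ (_ , u) → ∉[] (covers u)) (λ (_ , u) → ∉[] (covers u)) (λ ())
    where
    ∉[] : ∀ {B : Set} {x} → x ∈ [] → B
    ∉[] ()
  Subtype-finite p (y ∷ L) covers =
    let c , |py|   = IsTrue-card (p y)
        k , |rest| = Subtype-finite (p ∖ y) L covers′
    in c + k , ↔-trans (HasCard-⊎ |py| |rest|) (Subtype-split p y)
    where
    covers′ : ∀ {x} → IsTrue ((p ∖ y) x) → x ∈ L
    covers′ u with ∖-elim p u
    ... | x≢y , v with covers v
    ...   | here x≡y  = contradiction x≡y x≢y
    ...   | there x∈L = x∈L

-- Partitions with no repeated odd part, structurally

odd-suc : ∀ {x} → isOdd x ≡ false → isOdd (suc x) ≡ true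
odd-suc {0}           _ = refl
odd-suc {suc zero}    ()
odd-suc {suc (suc x)} e = odd-suc {x} e

even-pred : ∀ {x} → isOdd (suc x) ≡ true → isOdd x ≡ false
even-pred {0}           _ = refl
even-pred {suc zero}    ()
even-pred {suc (suc x)} o = even-pred {x} o

-- On a non-increasing list, "no odd part is repeated" becomes a condition on
-- neighbours: x ⊵ y says that y may follow x.
infix 4 _⊵_

data _⊵_ : ℕ → ℕ → Set where
  strict     : ∀ {x y} → y < x → x ⊵ y
  evenRepeat : ∀ {x} → isOdd x ≡ false → x ⊵ x

⊵⇒≥ : ∀ {x y} → x ⊵ y → x ≥ y
⊵⇒≥ (strict y<x)   = <⇒≤ y<x
⊵⇒≥ (evenRepeat _) = ≤-refl

≤⇒⊵ : ∀ {x y} → isOdd x ≡ false → y ≤ x → x ⊵ y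
≤⇒⊵ e y≤x with m≤n⇒m<n∨m≡n y≤x
... | inj₁ y<x  = strict y<x
... | inj₂ refl = evenRepeat e

PodList : List ℕ → Set
PodList xs = All (0 <_) xs × Linked _⊵_ xs

PodPartition : ℕ → List ℕ → Set
PodPartition n xs = PodList xs × sum xs ≡ n

TopEvenOnce : List ℕ → Set
TopEvenOnce []      = ⊥
TopEvenOnce (x ∷ r) = isOdd x ≡ false × All (_< x) r

O3Partition : ℕ → List ℕ → Set
O3Partition n xs = PodPartition n xs × TopEvenOnce xs

≥-top : ∀ {x r} → Linked _≥_ (x ∷ r) → All (_≤ x) r
≥-top s = All.tail (Linked⇒All (λ x≥y y≥z → ≤-trans y≥z x≥y) ≤-refl s)

⊵-top : ∀ {x r} → Linked _⊵_ (x ∷ r) → All (_≤ x) r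
⊵-top c = ≥-top (Linked.map ⊵⇒≥ c)

⊵-below : ∀ {x y r} → y < x → Linked _⊵_ (y ∷ r) → All (_< x) (y ∷ r)
⊵-below y<x c = y<x ∷ All.map (λ z≤y → ≤-<-trans z≤y y<x) (⊵-top c)

oddTop-strict : ∀ {x r} → isOdd x ≡ true → Linked _⊵_ (x ∷ r) → All (_< x) r
oddTop-strict _ [-]                = []
oddTop-strict _ (strict y<x ∷ c)   = ⊵-below y<x c
oddTop-strict o (evenRepeat e ∷ _) = contradiction (trans (sym o) e) λ ()

PodList-tail : ∀ {x r} → PodList (x ∷ r) → PodList r
PodList-tail (0<xs , c) = All.tail 0<xs , Linked.tail c

PodList-cons : ∀ {x r} → 0 < x → All (x ⊵_) r → PodList r → PodList (x ∷ r)
PodList-cons 0<x []        ([] , [])  = 0<x ∷ [] , [-]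
PodList-cons 0<x (x⊵y ∷ _) (0<r , c) = 0<x ∷ 0<r , x⊵y ∷ c

occ-here : ∀ x r → occ x (x ∷ r) ≡ suc (occ x r)
occ-here x r = cong length (filter-accept (T? ∘ (_≡ᵇ x)) {x} {r} (≡⇒≡ᵇ x x refl))

occ-≢ : ∀ {x y r} → ¬ y ≡ x → occ x (y ∷ r) ≡ occ x r
occ-≢ {x} {y} {r} y≢x = cong length (filter-reject (T? ∘ (_≡ᵇ x)) {y} {r} (y≢x ∘ ≡ᵇ⇒≡ y x))

occ-∷-≤ : ∀ {x y r} → occ x r ≤ occ x (y ∷ r)
occ-∷-≤ {x} {y} {r} with y ≟ x
... | yes refl = subst (occ x r ≤_) (sym (occ-here x r)) (n≤1+n _)
... | no  y≢x  = ≤-reflexive (sym (occ-≢ y≢x))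

occ-absent : ∀ {x r} → All (_< x) r → occ x r ≡ 0
occ-absent []           = refl
occ-absent (y<x ∷ r<x) = trans (occ-≢ (<⇒≢ y<x)) (occ-absent r<x)

occ-absent⁻ : ∀ {x r} → All (_≤ x) r → occ x r ≡ 0 → All (_< x) r
occ-absent⁻ []                 _  = []
occ-absent⁻ {x} {y ∷ r} (y≤x ∷ r≤x) o with y ≟ x
... | yes refl = contradiction (trans (sym (occ-here x r)) o) λ ()
... | no  y≢x  = ≤∧≢⇒< y≤x y≢x ∷ occ-absent⁻ r≤x (trans (sym (occ-≢ y≢x)) o)

occ-twice : ∀ {x r} → 2 ≤ occ x (x ∷ x ∷ r)
occ-twice {x} {r} = subst (2 ≤_) (sym (trans (occ-here x (x ∷ r)) (cong suc (occ-here x r)))) (s≤s (s≤s z≤n))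

T-≡ᵇ : ∀ {m n} → T (m ≡ᵇ n) ⇔ m ≡ n
T-≡ᵇ {m} {n} = mk⇔ (≡ᵇ⇒≡ m n) (≡⇒≡ᵇ m n)

T-allPos : ∀ xs → T (allPos xs) ⇔ All (0 <_) xs
T-allPos []           = mk⇔ (λ _ → []) (λ _ → tt)
T-allPos (zero ∷ xs)  = mk⇔ (λ ()) (λ { (() ∷ _) })
T-allPos (suc x ∷ xs) = mk⇔ (λ t → s≤s z≤n ∷ to ih t) (λ { (_ ∷ 0<xs) → from ih 0<xs })
  where ih = T-allPos xs

T-nonIncr : ∀ xs → T (nonIncr xs) ⇔ Linked _≥_ xs
T-nonIncr []           = mk⇔ (λ _ → []) (λ _ → tt)
T-nonIncr (x ∷ [])     = mk⇔ (λ _ → [-]) (λ _ → tt)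
T-nonIncr (x ∷ ys@(y ∷ _)) = ⇔-trans T-∧ (mk⇔
  (λ (t , ts) → ≤ᵇ⇒≤ y x t ∷ to (T-nonIncr ys) ts)
  (λ s → ≤⇒≤ᵇ (Linked.head s) , from (T-nonIncr ys) (Linked.tail s)))

T-isPartition : ∀ n xs → T (isPartition n xs) ⇔ (All (0 <_) xs × Linked _≥_ xs × sum xs ≡ n)
T-isPartition n xs = ⇔-trans T-∧ (T-allPos xs ×-⇔ ⇔-trans T-∧ (T-nonIncr xs ×-⇔ T-≡ᵇ))

oddOnceIn : List ℕ → ℕ → Bool
oddOnceIn xs y = not (isOdd y) ∨ (occ y xs ≤ᵇ 1)

-- `noOddRepeated` runs a local `go` that cannot be named from here; the
-- meta below is solved to it by unification.
mutual
  noOddRepeated-go : List ℕ → List ℕ → Bool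
  noOddRepeated-go = _

  noOddRepeated-∷ : ∀ x r → noOddRepeated (x ∷ r) ≡ (oddOnceIn (x ∷ r) x ∧ noOddRepeated-go (x ∷ r) r)
  noOddRepeated-∷ x r with x ∷ r
  ... | xs = refl

noOddRepeated≡all : ∀ xs → noOddRepeated xs ≡ all (oddOnceIn xs) xs
noOddRepeated≡all []      = refl
noOddRepeated≡all (x ∷ r) = trans (noOddRepeated-∷ x r) (cong (oddOnceIn (x ∷ r) x ∧_) (go≡all r))
  where
  go≡all : ∀ ys → noOddRepeated-go (x ∷ r) ys ≡ all (oddOnceIn (x ∷ r)) ys
  go≡all []       = refl
  go≡all (y ∷ ys) = cong (oddOnceIn (x ∷ r) y ∧_) (go≡all ys)

OddOnceIn : List ℕ → ℕ → Set
OddOnceIn xs y = isOdd y ≡ true → occ y xs ≤ 1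

T-oddOnceIn : ∀ xs y → T (oddOnceIn xs y) ⇔ OddOnceIn xs y
T-oddOnceIn xs y with isOdd y
... | false = mk⇔ (λ _ ()) (λ _ → tt)
... | true  = mk⇔ (λ t _ → ≤ᵇ⇒≤ _ 1 t) (λ h → ≤⇒≤ᵇ (h refl))

oddParts≢top : ∀ {x r} → Linked _⊵_ (x ∷ r) → All (λ z → isOdd z ≡ true → ¬ z ≡ x) r
oddParts≢top {x} c with isOdd x in e
... | true  = All.map (λ z<x _ → <⇒≢ z<x) (oddTop-strict e c)
... | false = All.universal (λ z o z≡x → contradiction (trans (sym o) (trans (cong isOdd z≡x) e)) λ ()) _

⊵⇒oddOnce : ∀ xs → Linked _⊵_ xs → All (OddOnceIn xs) xs
⊵⇒oddOnce []      _ = []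
⊵⇒oddOnce (x ∷ r) c = top ∷ All.zipWith rest (⊵⇒oddOnce r (Linked.tail c) , oddParts≢top c)
  where
  top : OddOnceIn (x ∷ r) x
  top o = ≤-reflexive (trans (occ-here x r) (cong suc (occ-absent (oddTop-strict o c))))
  rest : ∀ {z} → OddOnceIn r z × (isOdd z ≡ true → ¬ z ≡ x) → OddOnceIn (x ∷ r) z
  rest (h , z≢x) o = subst (_≤ 1) (sym (occ-≢ (≢-sym (z≢x o)))) (h o)

oddOnce-step : ∀ {x y r} → y ≤ x → OddOnceIn (x ∷ y ∷ r) x → x ⊵ y
oddOnce-step {x} {r = r} y≤x once with m≤n⇒m<n∨m≡n y≤x
... | inj₁ y<x  = strict y<x
... | inj₂ refl with isOdd x in e
...   | false = evenRepeat e
...   | true  = contradiction (≤-trans (occ-twice {x} {r}) (once refl)) λ { (s≤s ()) }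

oddOnce⇒⊵ : ∀ xs → Linked _≥_ xs → All (OddOnceIn xs) xs → Linked _⊵_ xs
oddOnce⇒⊵ []          _         _         = []
oddOnce⇒⊵ (x ∷ [])    _         _         = [-]
oddOnce⇒⊵ (x ∷ y ∷ r) (y≤x ∷ s) (hx ∷ hs) =
  oddOnce-step y≤x hx ∷ oddOnce⇒⊵ (y ∷ r) s (All.map (λ h o → ≤-trans (occ-∷-≤ {y = x} {r = y ∷ r}) (h o)) hs)

T-noOddRepeated : ∀ {xs} → Linked _≥_ xs → T (noOddRepeated xs) ⇔ Linked _⊵_ xs
T-noOddRepeated {xs} s = mk⇔
  (λ t → oddOnce⇒⊵ xs s (All.map (to (T-oddOnceIn xs _))
           (all⁺ (oddOnceIn xs) xs (subst T (noOddRepeated≡all xs) t))))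
  (λ c → subst T (sym (noOddRepeated≡all xs))
           (all⁻ (oddOnceIn xs) (All.map (from (T-oddOnceIn xs _)) (⊵⇒oddOnce xs c))))

T-largestEvenOnce : ∀ {xs} → Linked _≥_ xs → T (largestEvenOnce xs) ⇔ TopEvenOnce xs
T-largestEvenOnce {[]}    _ = mk⇔ (λ ()) (λ ())
T-largestEvenOnce {x ∷ r} s = ⇔-trans T-∧ (T-not-≡ ×-⇔ ⇔-trans T-≡ᵇ once⇔below)
  where
  once⇔below : occ x (x ∷ r) ≡ 1 ⇔ All (_< x) r
  once⇔below = mk⇔ (λ once → occ-absent⁻ (≥-top s) (suc-injective (trans (sym (occ-here x r)) once)))
                   (λ r<x → trans (occ-here x r) (cong suc (occ-absent r<x)))

isPod : ℕ → List ℕ → Bool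
isPod n xs = isPartition n xs ∧ noOddRepeated xs

isO3 : ℕ → List ℕ → Bool
isO3 n xs = isPartition n xs ∧ noOddRepeated xs ∧ largestEvenOnce xs

T-isPod : ∀ n xs → T (isPod n xs) ⇔ PodPartition n xs
T-isPod n xs = ⇔-trans T-∧ (mk⇔
  (λ (tp , tn) → let 0<xs , s , Σ≡n = to (T-isPartition n xs) tp
                 in (0<xs , to (T-noOddRepeated s) tn) , Σ≡n)
  (λ ((0<xs , c) , Σ≡n) → let s = Linked.map ⊵⇒≥ c
                          in from (T-isPartition n xs) (0<xs , s , Σ≡n) , from (T-noOddRepeated s) c))

T-isO3 : ∀ n xs → T (isO3 n xs) ⇔ O3Partition n xs
T-isO3 n xs rewrite sym (∧-assoc (isPartition n xs) (noOddRepeated xs) (largestEvenOnce xs)) =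
  ⇔-trans T-∧ (mk⇔
    (λ (tp , tl) → let pod = to (T-isPod n xs) tp
                   in pod , to (T-largestEvenOnce (sorted pod)) tl)
    (λ (pod , top) → from (T-isPod n xs) pod , from (T-largestEvenOnce (sorted pod)) top))
  where
  sorted : PodPartition n xs → Linked _≥_ xs
  sorted ((_ , c) , _) = Linked.map ⊵⇒≥ c

isPod-spec : ∀ {n xs} → IsTrue (isPod n xs) ⇔ PodPartition n xs
isPod-spec {n} {xs} = ⇔-trans IsTrue⇔T (T-isPod n xs)

isO3-spec : ∀ {n xs} → IsTrue (isO3 n xs) ⇔ O3Partition n xs
isO3-spec {n} {xs} = ⇔-trans IsTrue⇔T (T-isO3 n xs)

-- The bijection

oddTopImage : ℕ → List ℕ → List ℕ ⊎ List ℕ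
oddTopImage x []      = inj₂ (x ∷ [])
oddTopImage x (y ∷ r) with x ≟ y
... | yes _ = inj₁ (2 + x ∷ suc x ∷ r)
... | no  _ = inj₂ (x ∷ y ∷ r)

toO3 : List ℕ → List ℕ ⊎ List ℕ
toO3 []      = inj₂ []
toO3 (x ∷ r) = if isOdd x then oddTopImage (pred x) r else inj₁ (2 + x ∷ r)

evenTopPreimage : ℕ → List ℕ → List ℕ
evenTopPreimage w []      = w ∷ []
evenTopPreimage w (y ∷ r) with suc w ≟ y
... | yes _ = suc w ∷ w ∷ r
... | no  _ = w ∷ y ∷ r

fromO3 : List ℕ ⊎ List ℕ → List ℕ
fromO3 (inj₁ [])      = []
fromO3 (inj₁ (x ∷ r)) = evenTopPreimage (x ∸ 2) r
fromO3 (inj₂ [])      = []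
fromO3 (inj₂ (x ∷ r)) = suc x ∷ r

toO3-evenTop : ∀ {x r} → isOdd x ≡ false → toO3 (x ∷ r) ≡ inj₁ (2 + x ∷ r)
toO3-evenTop e rewrite e = refl

toO3-oddPair : ∀ {x r} → isOdd x ≡ false → toO3 (suc x ∷ x ∷ r) ≡ inj₁ (2 + x ∷ suc x ∷ r)
toO3-oddPair {x} e rewrite odd-suc {x} e with x ≟ x
... | yes _   = refl
... | no  x≢x = contradiction refl x≢x

toO3-oddAlone : ∀ {x r} → isOdd x ≡ false → All (_< x) r → toO3 (suc x ∷ r) ≡ inj₂ (x ∷ r)
toO3-oddAlone {x} e [] rewrite odd-suc {x} e = refl
toO3-oddAlone {x} {y ∷ _} e (y<x ∷ _) rewrite odd-suc {x} e with x ≟ y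
... | yes x≡y = contradiction (sym x≡y) (<⇒≢ y<x)
... | no  _   = refl

fromO3-pairTop : ∀ {w r} → fromO3 (inj₁ (2 + w ∷ suc w ∷ r)) ≡ suc w ∷ w ∷ r
fromO3-pairTop {w} with suc w ≟ suc w
... | yes _   = refl
... | no  w≢w = contradiction refl w≢w

fromO3-aloneTop : ∀ {w r} → All (_≤ w) r → fromO3 (inj₁ (2 + w ∷ r)) ≡ w ∷ r
fromO3-aloneTop []                    = refl
fromO3-aloneTop {w} {y ∷ _} (y≤w ∷ _) with suc w ≟ y
... | yes refl = contradiction y≤w 1+n≰n
... | no  _    = refl

data PodTop : List ℕ → Set where
  evenTop  : ∀ {x r} → isOdd x ≡ false → PodTop (x ∷ r)
  oddPair  : ∀ {x r} → isOdd x ≡ false → PodTop (suc x ∷ x ∷ r)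
  oddAlone : ∀ {x r} → isOdd x ≡ false → 0 < x → All (_< x) r → PodTop (suc x ∷ r)

podTop-odd : ∀ {m x r} → isOdd x ≡ true → Linked _⊵_ (x ∷ r) → x + sum r ≡ 2 + m → PodTop (x ∷ r)
podTop-odd {x = zero}        ()
podTop-odd {x = suc zero}    {[]} _ _ ()
podTop-odd {x = suc (suc x)} {[]} o _ _ = oddAlone (even-pred {suc x} o) (s≤s z≤n) []
podTop-odd {x = suc x} o (evenRepeat e ∷ _) _ = contradiction (trans (sym o) e) λ ()
podTop-odd {x = suc x} o (strict (s≤s y≤x) ∷ c) _ with m≤n⇒m<n∨m≡n y≤x
... | inj₁ y<x  = oddAlone (even-pred {x} o) (≤-<-trans z≤n y<x) (⊵-below y<x c)
... | inj₂ refl = oddPair (even-pred {x} o)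

podTop : ∀ {m xs} → PodPartition (2 + m) xs → PodTop xs
podTop {xs = []}    (_ , ())
podTop {xs = x ∷ r} ((_ , c) , Σ≡) with isOdd x in e
... | false = evenTop e
... | true  = podTop-odd e c Σ≡

data O3Top : List ℕ → Set where
  pairTop  : ∀ {w r} → isOdd w ≡ false → 0 < w → O3Top (2 + w ∷ suc w ∷ r)
  aloneTop : ∀ {w r} → isOdd w ≡ false → 0 < w → All (_≤ w) r → O3Top (2 + w ∷ r)

PodList-1 : ∀ {r} → PodList (1 ∷ r) → r ≡ []
PodList-1 (_ , [-])                               = refl
PodList-1 ((_ ∷ () ∷ _) , strict (s≤s z≤n) ∷ _)
PodList-1 (_ , evenRepeat () ∷ _)

pairTop-positive : ∀ {m w r} → PodList (suc w ∷ r) → suc (suc w) + (suc w + sum r) ≡ 4 + m → 0 < w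
pairTop-positive {w = suc _} _ _  = s≤s z≤n
pairTop-positive {w = zero}  l Σ≡ with PodList-1 l
... | refl = contradiction Σ≡ λ ()

o3Top : ∀ {m xs} → O3Partition (4 + m) xs → O3Top xs
o3Top {xs = []}                     (_ , ())
o3Top {xs = zero ∷ _}               ((((() ∷ _) , _) , _) , _)
o3Top {xs = suc zero ∷ _}           (_ , () , _)
o3Top {xs = suc (suc zero) ∷ []}    ((_ , ()) , _)
o3Top {xs = suc (suc (suc w)) ∷ []} (_ , e , _) = aloneTop e (s≤s z≤n) []
o3Top {xs = suc (suc w) ∷ y ∷ r} ((l@(_ ∷ 0<y ∷ _ , _ ∷ c) , Σ≡) , e , s≤s y≤1+w ∷ _)
  with m≤n⇒m<n∨m≡n y≤1+w
... | inj₁ (s≤s y≤w) = aloneTop e (≤-trans 0<y y≤w) (y≤w ∷ All.map (λ z≤y → ≤-trans z≤y y≤w) (⊵-top c))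
... | inj₂ refl      = pairTop e (pairTop-positive (PodList-tail l) Σ≡)

evenTop-raise : ∀ {n x r} → isOdd x ≡ false → PodPartition n (x ∷ r) → O3Partition (2 + n) (2 + x ∷ r)
evenTop-raise e (l@(_ , c) , Σ≡) =
  (PodList-cons (s≤s z≤n) (All.map strict r<2+x) (PodList-tail l) , cong (2 +_) Σ≡) , e , r<2+x
  where
  r<2+x = All.map (λ y≤x → s≤s (m≤n⇒m≤1+n y≤x)) (⊵-top c)

oddPair-raise : ∀ {n x r} → isOdd x ≡ false → PodPartition n (suc x ∷ x ∷ r) →
                O3Partition (2 + n) (2 + x ∷ suc x ∷ r)
oddPair-raise {x = x} {r} e (l , Σ≡) =
  (PodList-cons (s≤s z≤n) (All.map strict below) l′ , cong (2 +_) (trans (+-suc x (x + sum r)) Σ≡)) , e , below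
  where
  tail = PodList-tail l
  r≤x = ⊵-top (proj₂ tail)
  below : All (_< 2 + x) (suc x ∷ r)
  below = ≤-refl ∷ All.map (λ y≤x → s≤s (m≤n⇒m≤1+n y≤x)) r≤x
  l′ : PodList (suc x ∷ r)
  l′ = PodList-cons (s≤s z≤n) (All.map (strict ∘ s≤s) r≤x) (PodList-tail tail)

oddAlone-lower : ∀ {n x r} → isOdd x ≡ false → 0 < x → All (_< x) r →
                 PodPartition (suc n) (suc x ∷ r) → O3Partition n (x ∷ r)
oddAlone-lower e 0<x r<x (l , Σ≡) =
  (PodList-cons 0<x (All.map strict r<x) (PodList-tail l) , suc-injective Σ≡) , e , r<x

pairTop-lower : ∀ {n w r} → isOdd w ≡ false → 0 < w →
                O3Partition (2 + n) (2 + w ∷ suc w ∷ r) → PodPartition n (suc w ∷ w ∷ r)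
pairTop-lower {w = w} {r} e 0<w ((l , Σ≡) , _) =
  PodList-cons (s≤s z≤n) (All.map strict (≤-refl ∷ r<1+w)) l′ ,
  trans (sym (+-suc w (w + sum r))) (suc-injective (suc-injective Σ≡))
  where
  tail = PodList-tail l
  r<1+w = oddTop-strict (odd-suc {w} e) (proj₂ tail)
  l′ : PodList (w ∷ r)
  l′ = PodList-cons 0<w (All.map (≤⇒⊵ e ∘ ≤-pred) r<1+w) (PodList-tail tail)

aloneTop-lower : ∀ {n w r} → isOdd w ≡ false → 0 < w → All (_≤ w) r →
                 O3Partition (2 + n) (2 + w ∷ r) → PodPartition n (w ∷ r)
aloneTop-lower e 0<w r≤w ((l , Σ≡) , _) =
  PodList-cons 0<w (All.map (≤⇒⊵ e) r≤w) (PodList-tail l) , suc-injective (suc-injective Σ≡)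

o3-raise : ∀ {n x r} → O3Partition n (x ∷ r) → PodPartition (suc n) (suc x ∷ r)
o3-raise ((l , Σ≡) , _ , r<x) =
  PodList-cons (s≤s z≤n) (All.map (strict ∘ m<n⇒m<1+n) r<x) (PodList-tail l) , cong suc Σ≡

O3Either : ℕ → List ℕ ⊎ List ℕ → Set
O3Either m = [ O3Partition (4 + m) , O3Partition (1 + m) ]′

toO3-sound : ∀ {m xs} → PodPartition (2 + m) xs → O3Either m (toO3 xs)
toO3-sound {m} pod with podTop pod
... | evenTop {x} e          = subst (O3Either m) (sym (toO3-evenTop {x} e)) (evenTop-raise e pod)
... | oddPair {x} e          = subst (O3Either m) (sym (toO3-oddPair {x} e)) (oddPair-raise e pod)
... | oddAlone {x} e 0<x r<x = subst (O3Either m) (sym (toO3-oddAlone {x} e r<x)) (oddAlone-lower e 0<x r<x pod)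

fromO3-sound : ∀ {m s} → O3Either m s → PodPartition (2 + m) (fromO3 s)
fromO3-sound {m} {inj₁ _} o3 with o3Top o3
... | pairTop e 0<w =
  subst (PodPartition (2 + m)) (sym fromO3-pairTop) (pairTop-lower e 0<w o3)
... | aloneTop e 0<w r≤w =
  subst (PodPartition (2 + m)) (sym (fromO3-aloneTop r≤w)) (aloneTop-lower e 0<w r≤w o3)
fromO3-sound {s = inj₂ []}      (_ , ())
fromO3-sound {s = inj₂ (_ ∷ _)} o3 = o3-raise o3

fromO3∘toO3 : ∀ {m xs} → PodPartition (2 + m) xs → fromO3 (toO3 xs) ≡ xs
fromO3∘toO3 pod@((_ , c) , _) with podTop pod
... | evenTop {x} e       = trans (cong fromO3 (toO3-evenTop {x} e)) (fromO3-aloneTop (⊵-top c))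
... | oddPair {x} e       = trans (cong fromO3 (toO3-oddPair {x} e)) fromO3-pairTop
... | oddAlone {x} e _ r<x = cong fromO3 (toO3-oddAlone {x} e r<x)

toO3∘fromO3 : ∀ {m s} → O3Either m s → toO3 (fromO3 s) ≡ s
toO3∘fromO3 {s = inj₁ _} o3 with o3Top o3
... | pairTop {w} {r} e _   = trans (cong toO3 (fromO3-pairTop {w} {r})) (toO3-oddPair {w} e)
... | aloneTop {w} e _ r≤w = trans (cong toO3 (fromO3-aloneTop r≤w)) (toO3-evenTop {w} e)
toO3∘fromO3 {s = inj₂ []}      (_ , ())
toO3∘fromO3 {s = inj₂ (x ∷ _)} (_ , e , r<x) = toO3-oddAlone {x} e r<x

podSet↔o3Set⊎o3Set : ∀ m → PodSet (2 + m) ↔ (O3Set (4 + m) ⊎ O3Set (1 + m))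
podSet↔o3Set⊎o3Set m = ↔-trans
  (Subtype-↔ (λ {xs} → isPod-spec {2 + m} {xs}) (λ {s} → isO3-either-spec {s}) toO3 fromO3
    (λ {xs} → toO3-sound {m} {xs}) (λ {s} → fromO3-sound {m} {s})
    (λ {xs} → fromO3∘toO3 {m} {xs}) (λ {s} → toO3∘fromO3 {m} {s}))
  Σ-distribʳ-⊎
  where
  isO3-either-spec : ∀ {s} → IsTrue ([ isO3 (4 + m) , isO3 (1 + m) ]′ s) ⇔ O3Either m s
  isO3-either-spec {inj₁ _} = isO3-spec
  isO3-either-spec {inj₂ _} = isO3-spec

-- Counting

boundedLists : ℕ → ℕ → List (List ℕ)
boundedLists zero    b = [] ∷ []
boundedLists (suc l) b = [] ∷ cartesianProductWith _∷_ (upTo b) (boundedLists l b)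

∈-boundedLists : ∀ {l b xs} → length xs ≤ l → All (_< b) xs → xs ∈ boundedLists l b
∈-boundedLists {zero}  {xs = []}    _          _           = here refl
∈-boundedLists {suc l} {xs = []}    _          _           = here refl
∈-boundedLists {suc l} {xs = x ∷ xs} (s≤s len) (x<b ∷ xs<b) =
  there (∈-cartesianProductWith⁺ _∷_ (∈-upTo⁺ x<b) (∈-boundedLists len xs<b))

length≤sum : ∀ {xs} → All (0 <_) xs → length xs ≤ sum xs
length≤sum []           = z≤n
length≤sum (0<x ∷ 0<xs) = +-mono-≤ 0<x (length≤sum 0<xs)

parts≤sum : ∀ xs → All (_≤ sum xs) xs
parts≤sum []       = []
parts≤sum (x ∷ xs) = m≤m+n x (sum xs) ∷ All.map (λ y≤ → ≤-trans y≤ (m≤n+m (sum xs) x)) (parts≤sum xs)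

∈-boundedLists-sum : ∀ {xs} → All (0 <_) xs → xs ∈ boundedLists (sum xs) (suc (sum xs))
∈-boundedLists-sum {xs} 0<xs = ∈-boundedLists (length≤sum 0<xs) (All.map s≤s (parts≤sum xs))

o3Set-finite : ∀ n → Σ ℕ (HasCard (O3Set n))
o3Set-finite n = Subtype-finite (≡-dec _≟_) (isO3 n) (boundedLists n (suc n)) covered
  where
  covered : ∀ {xs} → IsTrue (isO3 n xs) → xs ∈ boundedLists n (suc n)
  covered {xs} u with to isO3-spec u
  ... | ((0<xs , _) , Σ≡) , _ = subst (λ k → xs ∈ boundedLists k (suc k)) Σ≡ (∈-boundedLists-sum 0<xs)

theorem1p6 : (n : ℕ) → 2 < n →
    Σ ℕ (λ a → Σ ℕ (λ b → Σ ℕ (λ c →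
      HasCard (O3Set (n + 2)) a × HasCard (O3Set (n ∸ 1)) b ×
      HasCard (PodSet n) c × (a + b ≡ c))))
theorem1p6 (suc (suc m)) _ rewrite +-comm m 2 =
  let a , |O3[n+2]| = o3Set-finite (4 + m)
      b , |O3[n-1]| = o3Set-finite (1 + m)
  in a , b , a + b , |O3[n+2]| , |O3[n-1]| ,
     ↔-trans (HasCard-⊎ |O3[n+2]| |O3[n-1]|) (↔-sym (podSet↔o3Set⊎o3Set m)) , refl
theorem1p6 (suc zero) (s≤s ())
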